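{- Let $k\geqslant 1$ be an integer, let $G=(V,E)$ be a minor-minimal non-$k$-graph, let $\langle c,x\rangle\geqslant k$ be a witness for $G$, and let $\mathcal F$ be a family of subsets of $V$ such that $\{\delta(S):S\in\mathcal F\}$ is a basis of minimum cuts. Then every edge of $G$ belongs to at least two of the cuts $\delta(S)$, $S\in\mathcal F$.
   Context: Graphs are finite, undirected, may have loops and parallel edges, and have at least two nodes. For $S\subseteq V$, $\delta(S)$ is the set of edges with exactly one endnode in $S$; $\chi^F$ is the characteristic vector of $F\subseteq E$ and $c(F)=\sum_{e\in F}c(e)$. The cut dominant is $\mathrm{CUT}(G)=\mathrm{conv}\{\chi^{\delta(S)} : \varnothing\neq S\subsetneq V\}+\mathbb{R}^E_+$. Each facet-defining inequality has a unique minimum integer form in which the coefficients of $c$ and the right-hand side are relatively prime integers. $G$ is a $k$-graph if every facet-defining inequality of $\mathrm{CUT}(G)$ in minimum integer form has right-hand side at most $k$; $k^*(G)$ is the least such $k$. $G$ is a minor-minimal non-$k$-graph if $k^*(G)>k$ and $k^*(G')\leqslant k$ for every proper minor $G'$ of $G$ (minors obtained by edge contractions, edge deletions and node deletions). A witness for $G$ is a facet-defining inequality $\langle c,x\rangle\geqslant k$ of $\mathrm{CUT}(G)$ whose minimum integer form has right-hand side strictly greater than $k$. For $c\ge0$, a minimum cut is a cut $\delta(S)$, $\varnothing\neq S\subsetneq V$, minimizing $c(\delta(S))$. "$\{\delta(S):S\in\mathcal F\}$ is a basis of minimum cuts" means $\mathcal F$ consists of $|E|$ sets $S$ with $\varnothing\neq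 S\subsetneq V$, each $\delta(S)$ a minimum cut with respect to $c$, with the vectors $\chi^{\delta(S)}$ linearly independent.
   Formalization: The cut dominant $\mathrm{CUT}(G)$ consists of its rational points only, and the coefficients $c$ of the witness are rational rather than real. -}

module Defs where

open import Data.Nat as ℕ using (ℕ; zero; suc)
open import Data.Integer as ℤ using (ℤ; +_)
open import Data.Integer.Divisibility as ℤD using ()
open import Data.Rational as ℚ using (ℚ; 0ℚ; 1ℚ; _/_)
open import Data.Fin using (Fin; zero; suc; punchIn; punchOut; _≟_)
open import Data.Bool using (Bool; true; false; _xor_; if_then_else_)
open import Data.Product using (Σ; ∃; ∃-syntax; _×_; _,_; proj₁; proj₂)
open import Data.List using (List; []; _∷_)
open import Function using (_∘_)
open import Relation.Nullary using (¬_; yes; no)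
open import Relation.Binary.PropositionalEquality using (_≡_; _≢_; refl; sym)

-- Graphs: nodes Fin nodes, edges Fin edges, each edge with two endnodes
-- (loops and parallel edges allowed).

record Graph : Set where
  constructor graph
  field
    nodes : ℕ
    edges : ℕ
    ends  : Fin edges → Fin nodes × Fin nodes
open Graph public

IsGraph : Graph → Set
IsGraph G = 2 ℕ.≤ nodes G

-- contracting a (non-loop) edge with ends u, w: node w is merged into u
mergeInto : ∀ {n} (u w : Fin (suc n)) → u ≢ w → Fin (suc n) → Fin n
mergeInto u w u≢w x with x ≟ w
... | yes _  = punchOut {i = w} {j = u} (λ eq → u≢w (sym eq))
... | no x≢w = punchOut {i = w} {j = x} (λ eq → x≢w (sym eq))

mapEnds : ∀ {A B : Set} → (A → B) → A × A → B × B
mapEnds f (a , b) = f a , f b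

data Step : Graph → Graph → Set where
  delEdge  : ∀ {n m} (f : Fin (suc m) → Fin n × Fin n) (e : Fin (suc m)) →
             Step (graph n (suc m) f) (graph n m (f ∘ punchIn e))
  -- deletion of an isolated node v (deleting a non-isolated node is
  -- obtained by first deleting its incident edges)
  delNode  : ∀ {n m} (f : Fin m → Fin (suc n) × Fin (suc n)) (v : Fin (suc n))
             (iso : ∀ d → (v ≢ proj₁ (f d)) × (v ≢ proj₂ (f d))) →
             Step (graph (suc n) m f)
                  (graph n m (λ d → punchOut (proj₁ (iso d)) , punchOut (proj₂ (iso d))))
  -- contraction of a non-loop edge e (contracting a loop = deleting it)
  contract : ∀ {n m} (f : Fin (suc m) → Fin (suc n) × Fin (suc n)) (e : Fin (suc m))
             (nl : proj₁ (f e) ≢ proj₂ (f e)) →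
             Step (graph (suc n) (suc m) f)
                  (graph n m (λ d → mapEnds (mergeInto (proj₁ (f e)) (proj₂ (f e)) nl)
                                            (f (punchIn e d))))

data ProperMinor : Graph → Graph → Set where
  one  : ∀ {G G'} → Step G G' → ProperMinor G' G
  more : ∀ {G G' G''} → Step G G' → ProperMinor G'' G' → ProperMinor G'' G

Σℚ : ∀ {m} → (Fin m → ℚ) → ℚ
Σℚ {zero}  f = 0ℚ
Σℚ {suc m} f = f zero ℚ.+ Σℚ (f ∘ suc)

⟨_,_⟩ : ∀ {m} → (Fin m → ℚ) → (Fin m → ℚ) → ℚ
⟨ c , x ⟩ = Σℚ (λ e → c e ℚ.* x e)

ℤtoℚ : ℤ → ℚ
ℤtoℚ z = z / 1

ℕtoℚ : ℕ → ℚ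
ℕtoℚ k = (+ k) / 1

Subset : ℕ → Set
Subset n = Fin n → Bool

NonTrivial : ∀ {n} → Subset n → Set
NonTrivial S = (∃[ v ] S v ≡ true) × (∃[ w ] S w ≡ false)

_∈δ_ : ∀ {G : Graph} → Fin (edges G) → Subset (nodes G) → Set
_∈δ_ {G} e S = S (proj₁ (ends G e)) xor S (proj₂ (ends G e)) ≡ true

χδ : (G : Graph) → Subset (nodes G) → Fin (edges G) → ℚ
χδ G S e = if S (proj₁ (ends G e)) xor S (proj₂ (ends G e)) then 1ℚ else 0ℚ

-- a convex combination of cut vectors: list of (coefficient, set)
sumCombo : (G : Graph) → List (ℚ × Subset (nodes G)) → Fin (edges G) → ℚ
sumCombo G []            e = 0ℚ
sumCombo G ((μ , S) ∷ l) e = μ ℚ.* χδ G S e ℚ.+ sumCombo G l e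

sumCoeffs : ∀ {A : Set} → List (ℚ × A) → ℚ
sumCoeffs []            = 0ℚ
sumCoeffs ((μ , _) ∷ l) = μ ℚ.+ sumCoeffs l

data AllOK {n} : List (ℚ × Subset n) → Set where
  []  : AllOK []
  _∷_ : ∀ {μ S l} → (0ℚ ℚ.≤ μ) × NonTrivial S → AllOK l → AllOK ((μ , S) ∷ l)

-- the cut dominant CUT(G) = conv{χ^δ(S)} + ℝ^E_+  (rational points)
InCUT : (G : Graph) → (Fin (edges G) → ℚ) → Set
InCUT G x = Σ (List (ℚ × Subset (nodes G))) λ l →
  AllOK l × (sumCoeffs l ≡ 1ℚ) × (∀ e → sumCombo G l e ℚ.≤ x e)

ValidIneq : (G : Graph) → (Fin (edges G) → ℚ) → ℚ → Set
ValidIneq G c b = ∀ x → InCUT G x → b ℚ.≤ ⟨ c , x ⟩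

AffinelyIndependent : ∀ {p m} → (Fin p → (Fin m → ℚ)) → Set
AffinelyIndependent {p} {m} pts =
  ∀ (μ : Fin p → ℚ) → Σℚ μ ≡ 0ℚ → (∀ e → Σℚ (λ i → μ i ℚ.* pts i e) ≡ 0ℚ) →
  ∀ i → μ i ≡ 0ℚ

-- ⟨c,x⟩ ≥ b is facet-defining for CUT(G) (a full-dimensional polyhedron
-- in ℝ^E): it is valid, non-trivial (c ≠ 0), and the face it defines
-- contains |E| affinely independent points.
FacetDefining : (G : Graph) → (Fin (edges G) → ℚ) → ℚ → Set
FacetDefining G c b =
  ValidIneq G c b × (∃[ e ] c e ≢ 0ℚ) ×
  Σ (Fin (edges G) → (Fin (edges G) → ℚ)) λ pts →
    (∀ i → InCUT G (pts i) × (⟨ c , pts i ⟩ ≡ b)) × AffinelyIndependent pts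

MinIntForm : ∀ {m} → (Fin m → ℚ) → ℚ → (Fin m → ℤ) → ℤ → Set
MinIntForm c b a r =
  (∃[ t ] (0ℚ ℚ.< t) × (∀ e → ℤtoℚ (a e) ≡ t ℚ.* c e) × (ℤtoℚ r ≡ t ℚ.* b)) ×
  (∀ (d : ℕ) → (∀ e → (+ d) ℤD.∣ a e) → (+ d) ℤD.∣ r → d ≡ 1)

IsKGraph : ℕ → Graph → Set
IsKGraph k G = ∀ c b → FacetDefining G c b →
  ∀ a r → MinIntForm c b a r → r ℤ.≤ + k

MinorMinimalNonK : ℕ → Graph → Set
MinorMinimalNonK k G =
  ¬ IsKGraph k G × (∀ G' → ProperMinor G' G → IsGraph G' → IsKGraph k G')

Witness : ℕ → (G : Graph) → (Fin (edges G) → ℚ) → Set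
Witness k G c = FacetDefining G c (ℕtoℚ k) ×
  (∃[ a ] ∃[ r ] MinIntForm c (ℕtoℚ k) a r × (+ k ℤ.< r))

cutWeight : (G : Graph) → (Fin (edges G) → ℚ) → Subset (nodes G) → ℚ
cutWeight G c S = ⟨ c , χδ G S ⟩

MinCut : (G : Graph) → (Fin (edges G) → ℚ) → Subset (nodes G) → Set
MinCut G c S = NonTrivial S × (∀ T → NonTrivial T → cutWeight G c S ℚ.≤ cutWeight G c T)

BasisOfMinCuts : (G : Graph) → (Fin (edges G) → ℚ) → (Fin (edges G) → Subset (nodes G)) → Set
BasisOfMinCuts G c F =
  (∀ i → MinCut G c (F i)) ×
  (∀ (μ : Fin (edges G) → ℚ) → (∀ e → Σℚ (λ i → μ i ℚ.* χδ G (F i) e) ≡ 0ℚ) →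
     ∀ i → μ i ≡ 0ℚ)

-- Every minimum cut is tight, i.e. has weight k (the facet contains a
-- point of CUT(G), and c ≥ 0 since CUT(G) is a dominant). If e lies in no basis
-- cut, the |E| independent cut vectors live in the (|E|-1)-dimensional
-- coordinate space of E ∖ {e}: impossible. If e lies in exactly one basis cut
-- δ(F i₀): when e is the only edge the minimum integer form (a , r) has r = a(e),
-- forcing |r| = 1 < r; on two nodes every non-trivial cut contains the non-loop
-- e; otherwise the remaining |E|-1 basis cuts avoid e and descend to the
-- contraction G/e, where they span the facet of ⟨c/e,x⟩ ≥ k, and since
-- r = a(δ(F i₀)) the coefficient a(e) is an integer combination of r and the
-- other coefficients, so (a/e , r) is still a minimum integer form: a witness
-- for the proper minor G/e, contradicting minimality.
module Submission where

open import Defs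
open import Algebra.Bundles using (Ring)
import Algebra.Properties.Semiring.Sum as SemiringSum
open import Data.Nat as ℕ using (ℕ; zero; suc)
open import Data.Fin using (Fin; zero; suc; punchIn; punchOut; _≟_)
open import Data.Fin.Properties using (punchIn-punchOut; punchOut-punchIn; punchOut-cong; punchInᵢ≢i; any?; ¬∀⟶∃¬)
open import Data.Vec.Functional using (insertAt)
open import Data.Vec.Functional.Properties using (insertAt-lookup; insertAt-punchIn)
open import Data.Rational as ℚ using (ℚ; 0ℚ; 1ℚ; _+_; _*_; -_; _-_; _≤_)
import Data.Rational.Properties as ℚP
open import Data.Rational.Solver using (module +-*-Solver)
open import Data.Integer as ℤ using (ℤ)
import Data.Integer.Properties as ℤP
import Data.Integer.Divisibility as ℤD
import Data.Integer.Divisibility.Signed as ℤ∣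
import Data.Nat.Divisibility as ℕD
import Data.Nat.Properties as ℕP
open import Data.Bool using (true; false; _xor_; if_then_else_)
import Data.Bool.Properties as Bool
open import Data.Bool.Properties using (xor-same)
import Data.Rational.Unnormalised as ℚᵘ
open import Data.Rational.Unnormalised using (mkℚᵘ; _≃_) renaming (_+_ to _+ᵘ_)
import Data.Rational.Unnormalised.Properties as ℚᵘP
open import Data.Product using (Σ; ∃; ∃-syntax; _×_; _,_; proj₁; proj₂; map₂)
open import Data.Empty using (⊥; ⊥-elim)
import Data.List as List
open import Data.List using (List; []; _∷_)
open import Function using (_∘_)
open import Relation.Nullary using (¬_; yes; no; ¬?)
open import Relation.Nullary.Decidable using (decidable-stable; _×-dec_)
open import Relation.Unary using (Decidable)
open import Relation.Binary.Definitions using () renaming (Decidable to Decidable₂)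
open import Relation.Binary.PropositionalEquality
open ≡-Reasoning
import Relation.Binary.Reasoning.Setoid as SetoidReasoning

open +-*-Solver
module ℚΣ = SemiringSum (Ring.semiring ℚP.+-*-ring)
module ℤΣ = SemiringSum ℤP.+-*-semiring

-- Σℚ is the library summation over the additive monoid of ℚ, so its
-- algebraic properties are inherited from the library.
Σℚ≡sum : ∀ {m} (f : Fin m → ℚ) → Σℚ f ≡ ℚΣ.sum f
Σℚ≡sum {zero}  f = refl
Σℚ≡sum {suc m} f = cong (f zero +_) (Σℚ≡sum (f ∘ suc))

Σℚ-cong : ∀ {m} {f g : Fin m → ℚ} → (∀ i → f i ≡ g i) → Σℚ f ≡ Σℚ g
Σℚ-cong {f = f} {g} f≗g = begin
  Σℚ f        ≡⟨ Σℚ≡sum f ⟩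
  ℚΣ.sum f    ≡⟨ ℚΣ.sum-cong-≗ f≗g ⟩
  ℚΣ.sum g    ≡⟨ Σℚ≡sum g ⟨
  Σℚ g        ∎

Σℚ-zero : ∀ {m} {f : Fin m → ℚ} → (∀ i → f i ≡ 0ℚ) → Σℚ f ≡ 0ℚ
Σℚ-zero {m} f≗0 = trans (Σℚ-cong f≗0) (trans (Σℚ≡sum {m} (λ _ → 0ℚ)) (ℚΣ.sum-replicate-zero m))

Σℚ-+ : ∀ {m} (f g : Fin m → ℚ) → Σℚ (λ i → f i + g i) ≡ Σℚ f + Σℚ g
Σℚ-+ f g = begin
  Σℚ (λ i → f i + g i)          ≡⟨ Σℚ≡sum (λ i → f i + g i) ⟩
  ℚΣ.sum (λ i → f i + g i)      ≡⟨ ℚΣ.∑-distrib-+ f g ⟩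
  ℚΣ.sum f + ℚΣ.sum g           ≡⟨ cong₂ _+_ (Σℚ≡sum f) (Σℚ≡sum g) ⟨
  Σℚ f + Σℚ g                   ∎

Σℚ-*ˡ : ∀ {m} (a : ℚ) (f : Fin m → ℚ) → Σℚ (λ i → a * f i) ≡ a * Σℚ f
Σℚ-*ˡ a f = begin
  Σℚ (λ i → a * f i)       ≡⟨ Σℚ≡sum (λ i → a * f i) ⟩
  ℚΣ.sum (λ i → a * f i)   ≡⟨ ℚΣ.*-distribˡ-sum a f ⟨
  a * ℚΣ.sum f             ≡⟨ cong (a *_) (Σℚ≡sum f) ⟨
  a * Σℚ f                 ∎

Σℚ-split : ∀ {m} (j : Fin (suc m)) (f : Fin (suc m) → ℚ) → Σℚ f ≡ f j + Σℚ (f ∘ punchIn j)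
Σℚ-split j f = begin
  Σℚ f                              ≡⟨ Σℚ≡sum f ⟩
  ℚΣ.sum f                          ≡⟨ ℚΣ.sum-remove f ⟩
  f j + ℚΣ.sum (f ∘ punchIn j)      ≡⟨ cong (f j +_) (Σℚ≡sum (f ∘ punchIn j)) ⟨
  f j + Σℚ (f ∘ punchIn j)          ∎

Σℚ-mono : ∀ {m} {f g : Fin m → ℚ} → (∀ i → f i ≤ g i) → Σℚ f ≤ Σℚ g
Σℚ-mono {zero}  f≤g = ℚP.≤-refl
Σℚ-mono {suc m} f≤g = ℚP.+-mono-≤ (f≤g zero) (Σℚ-mono (f≤g ∘ suc))

punchIn-elim : ∀ {m} (P : Fin (suc m) → Set) (j : Fin (suc m)) →
  P j → (∀ d → P (punchIn j d)) → ∀ x → P x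
punchIn-elim P j Pj Pd x with j ≟ x
... | yes refl = Pj
... | no j≢x   = subst P (punchIn-punchOut j≢x) (Pd (punchOut j≢x))

Σℚ-insertAt : ∀ {m} (j : Fin (suc m)) (z : ℚ) (g : Fin m → ℚ) (h : Fin (suc m) → ℚ → ℚ) →
  Σℚ (λ x → h x (insertAt g j z x)) ≡ h j z + Σℚ (λ d → h (punchIn j d) (g d))
Σℚ-insertAt j z g h = trans (Σℚ-split j (λ x → h x (insertAt g j z x)))
  (cong₂ _+_ (cong (h j) (insertAt-lookup g j z))
             (Σℚ-cong λ d → cong (h (punchIn j d)) (insertAt-punchIn g j z d)))

lincomb : ∀ {p m} → (Fin p → ℚ) → (Fin p → Fin m → ℚ) → Fin m → ℚ
lincomb μ v e = Σℚ (λ i → μ i * v i e)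

LinearlyIndependent : ∀ {p m} → (Fin p → Fin m → ℚ) → Set
LinearlyIndependent v = ∀ μ → (∀ e → lincomb μ v e ≡ 0ℚ) → ∀ i → μ i ≡ 0ℚ

NontrivialRelation : ∀ {p m} → (Fin p → Fin m → ℚ) → Set
NontrivialRelation {p} v =
  Σ (Fin p → ℚ) λ μ → (∃ λ i → μ i ≢ 0ℚ) × (∀ e → lincomb μ v e ≡ 0ℚ)

lincomb-insertAt : ∀ {p m} (μ : Fin p → ℚ) (j : Fin (suc p)) (z : ℚ)
  (v : Fin (suc p) → Fin m → ℚ) (e : Fin m) →
  lincomb (insertAt μ j z) v e ≡ z * v j e + lincomb μ (v ∘ punchIn j) e
lincomb-insertAt μ j z v e = Σℚ-insertAt j z μ (λ i c → c * v i e)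

0*x+y≡y : ∀ x y → 0ℚ * x + y ≡ y
0*x+y≡y x y = trans (cong (_+ y) (ℚP.*-zeroˡ x)) (ℚP.+-identityˡ y)

relation-zero-column : ∀ {n} (v : Fin (suc (suc n)) → Fin (suc n) → ℚ) →
  (∀ i → v i zero ≡ 0ℚ) → NontrivialRelation (λ i e → v (suc i) (suc e)) →
  NontrivialRelation v
relation-zero-column v column≡0 (μ , (i , μi≢0) , relation) =
  insertAt μ zero 0ℚ , (suc i , μi≢0) , relation′
  where
  relation′ : ∀ e → lincomb (insertAt μ zero 0ℚ) v e ≡ 0ℚ
  relation′ zero    = trans (lincomb-insertAt μ zero 0ℚ v zero)
    (trans (0*x+y≡y (v zero zero) _) (Σℚ-zero λ i → trans (cong (μ i *_) (column≡0 (suc i))) (ℚP.*-zeroʳ (μ i))))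
  relation′ (suc e) = trans (lincomb-insertAt μ zero 0ℚ v (suc e)) (trans (0*x+y≡y (v zero (suc e)) _) (relation e))

module Elimination {n} (v : Fin (suc (suc n)) → Fin (suc n) → ℚ)
                   (j : Fin (suc (suc n))) (pivot≢0 : v j zero ≢ 0ℚ) where
  -- Gaussian elimination of the first coordinate using the pivot vector vⱼ.
  p : ℚ
  p = v j zero
  instance
    p-nonZero : ℚ.NonZero p
    p-nonZero = ℚ.≢-nonZero pivot≢0
  q : ℚ
  q = ℚ.1/ p

  eliminated : Fin (suc n) → Fin n → ℚ
  eliminated i e = v (punchIn j i) (suc e) - (v (punchIn j i) zero * q) * v j (suc e)

  lincomb-eliminated : ∀ μ e → lincomb μ eliminated e ≡
    lincomb μ (v ∘ punchIn j) (suc e) - (lincomb μ (v ∘ punchIn j) zero * q) * v j (suc e)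
  lincomb-eliminated μ e = begin
    Σℚ (λ i → μ i * eliminated i e)
      ≡⟨ Σℚ-cong (λ i → solve 5 (λ m a b q c → m :* (b :- (a :* q) :* c) := m :* b :+ (:- (q :* c)) :* (m :* a))
                                refl (μ i) (v (punchIn j i) zero) (v (punchIn j i) (suc e)) q (v j (suc e))) ⟩
    Σℚ (λ i → μ i * v (punchIn j i) (suc e) + (- (q * v j (suc e))) * (μ i * v (punchIn j i) zero))
      ≡⟨ Σℚ-+ (λ i → μ i * v (punchIn j i) (suc e)) (λ i → (- (q * v j (suc e))) * (μ i * v (punchIn j i) zero)) ⟩
    B + Σℚ (λ i → (- (q * v j (suc e))) * (μ i * v (punchIn j i) zero))
      ≡⟨ cong (B +_) (Σℚ-*ˡ (- (q * v j (suc e))) (λ i → μ i * v (punchIn j i) zero)) ⟩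
    B + (- (q * v j (suc e))) * A
      ≡⟨ solve 4 (λ b a q c → b :+ (:- (q :* c)) :* a := b :- (a :* q) :* c) refl B A q (v j (suc e)) ⟩
    B - (A * q) * v j (suc e) ∎
    where
    A B : ℚ
    A = lincomb μ (v ∘ punchIn j) zero
    B = lincomb μ (v ∘ punchIn j) (suc e)

  -- A relation μ among the eliminated vectors lifts to one among v by giving
  -- vⱼ the coefficient -A/p, where A is the first coordinate of Σᵢ μᵢ v_(punchIn j i).
  relation-pivot : NontrivialRelation eliminated → NontrivialRelation v
  relation-pivot (μ , (i , μi≢0) , relation) = μ′ , (punchIn j i , μ′≢0) , relation′
    where
    A λⱼ : ℚ
    A = lincomb μ (v ∘ punchIn j) zero
    λⱼ = - (A * q)
    μ′ : Fin (suc (suc n)) → ℚ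
    μ′ = insertAt μ j λⱼ
    μ′≢0 : μ′ (punchIn j i) ≢ 0ℚ
    μ′≢0 eq = μi≢0 (trans (sym (insertAt-punchIn μ j λⱼ i)) eq)
    relation′ : ∀ e → lincomb μ′ v e ≡ 0ℚ
    relation′ zero = begin
      lincomb μ′ v zero  ≡⟨ lincomb-insertAt μ j λⱼ v zero ⟩
      λⱼ * p + A         ≡⟨ solve 3 (λ a q p → :- (a :* q) :* p :+ a := a :* (con 1ℚ :- q :* p)) refl A q p ⟩
      A * (1ℚ - q * p)   ≡⟨ cong (λ x → A * (1ℚ - x)) (ℚP.*-inverseˡ p) ⟩
      A * (1ℚ - 1ℚ)      ≡⟨ solve 1 (λ a → a :* (con 1ℚ :- con 1ℚ) := con 0ℚ) refl A ⟩
      0ℚ                 ∎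
    relation′ (suc e) = begin
      lincomb μ′ v (suc e)       ≡⟨ lincomb-insertAt μ j λⱼ v (suc e) ⟩
      λⱼ * c + B                 ≡⟨ solve 4 (λ a q c b → :- (a :* q) :* c :+ b := b :- (a :* q) :* c) refl A q c B ⟩
      B - (A * q) * c            ≡⟨ lincomb-eliminated μ e ⟨
      lincomb μ eliminated e     ≡⟨ relation e ⟩
      0ℚ                         ∎
      where
      c B : ℚ
      c = v j (suc e)
      B = lincomb μ (v ∘ punchIn j) (suc e)

-- More vectors than coordinates: any n+1 vectors in ℚⁿ satisfy a non-trivial
-- linear relation (induction on n, eliminating the first coordinate).
dependent : ∀ n (v : Fin (suc n) → Fin n → ℚ) → NontrivialRelation v
dependent zero    v = (λ _ → 1ℚ) , (zero , λ ()) , λ ()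
dependent (suc n) v with any? (λ j → ¬? (v j zero ℚP.≟ 0ℚ))
... | yes (j , pivot≢0) = relation-pivot (dependent n eliminated)
  where open Elimination v j pivot≢0
... | no no-pivot = relation-zero-column v column≡0 (dependent n (λ i e → v (suc i) (suc e)))
  where
  column≡0 : ∀ i → v i zero ≡ 0ℚ
  column≡0 i = decidable-stable (v i zero ℚP.≟ 0ℚ) (λ vᵢ≢0 → no-pivot (i , vᵢ≢0))

independent-drop-coordinate : ∀ {p m} (v : Fin p → Fin (suc m) → ℚ) (e : Fin (suc m)) →
  (∀ i → v i e ≡ 0ℚ) → LinearlyIndependent v → LinearlyIndependent (λ i d → v i (punchIn e d))
independent-drop-coordinate v e vanish indep μ relation =
  indep μ (punchIn-elim (λ x → lincomb μ v x ≡ 0ℚ) e at-e relation)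
  where
  at-e : lincomb μ v e ≡ 0ℚ
  at-e = Σℚ-zero λ i → trans (cong (μ i *_) (vanish i)) (ℚP.*-zeroʳ (μ i))

independent-subfamily : ∀ {p m} (v : Fin (suc p) → Fin m → ℚ) (j : Fin (suc p)) →
  LinearlyIndependent v → LinearlyIndependent (v ∘ punchIn j)
independent-subfamily v j indep μ relation i =
  trans (sym (insertAt-punchIn μ j 0ℚ i)) (indep (insertAt μ j 0ℚ) relation′ (punchIn j i))
  where
  relation′ : ∀ e → lincomb (insertAt μ j 0ℚ) v e ≡ 0ℚ
  relation′ e = trans (lincomb-insertAt μ j 0ℚ v e) (trans (0*x+y≡y (v j e) _) (relation e))

independent-cong : ∀ {p m} {v w : Fin p → Fin m → ℚ} → (∀ i e → v i e ≡ w i e) →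
  LinearlyIndependent v → LinearlyIndependent w
independent-cong v≗w indep μ relation =
  indep μ (λ e → trans (Σℚ-cong λ i → cong (μ i *_) (v≗w i e)) (relation e))

independent-uses-coordinate : ∀ {m} (v : Fin m → Fin m → ℚ) → LinearlyIndependent v →
  ∀ e → ¬ (∀ i → v i e ≡ 0ℚ)
independent-uses-coordinate {suc m} v indep e vanish
  with dependent m (λ i d → v i (punchIn e d))
... | μ , (i , μᵢ≢0) , relation = μᵢ≢0 (independent-drop-coordinate v e vanish indep μ relation i)

⟨⟩-+ : ∀ {m} (c x y : Fin m → ℚ) → ⟨ c , (λ e → x e + y e) ⟩ ≡ ⟨ c , x ⟩ + ⟨ c , y ⟩
⟨⟩-+ c x y = trans (Σℚ-cong λ e → ℚP.*-distribˡ-+ (c e) (x e) (y e)) (Σℚ-+ (λ e → c e * x e) (λ e → c e * y e))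

⟨⟩-* : ∀ {m} (c x : Fin m → ℚ) (a : ℚ) → ⟨ c , (λ e → a * x e) ⟩ ≡ a * ⟨ c , x ⟩
⟨⟩-* c x a = trans (Σℚ-cong λ e → solve 3 (λ c a x → c :* (a :* x) := a :* (c :* x)) refl (c e) a (x e))
                   (Σℚ-*ˡ a (λ e → c e * x e))

⟨⟩-mono : ∀ {m} (c : Fin m → ℚ) {x y : Fin m → ℚ} → (∀ e → 0ℚ ≤ c e) → (∀ e → x e ≤ y e) →
  ⟨ c , x ⟩ ≤ ⟨ c , y ⟩
⟨⟩-mono c c≥0 x≤y = Σℚ-mono λ e → ℚP.*-monoˡ-≤-nonNeg (c e) {{ℚ.nonNegative (c≥0 e)}} (x≤y e)

0≤1 : 0ℚ ≤ 1ℚ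
0≤1 = ℚ.*≤* (ℤ.+≤+ ℕ.z≤n)

b≤b+x⇒0≤x : ∀ {b x} → b ≤ b + x → 0ℚ ≤ x
b≤b+x⇒0≤x {b} {x} b≤b+x = subst₂ _≤_ (ℚP.+-inverseˡ b)
  (solve 2 (λ b x → :- b :+ (b :+ x) := x) refl b x) (ℚP.+-monoʳ-≤ (- b) b≤b+x)

-- A valid inequality ⟨c,x⟩ ≥ b for an upward closed set P that is tight at
-- some point of P has nonnegative coefficients: raising one coordinate of the
-- tight point stays in P and raises ⟨c,x⟩ by the corresponding coefficient.
valid-tight⇒nonneg : ∀ {m} (P : (Fin m → ℚ) → Set) →
  (∀ {x y} → P x → (∀ e → x e ≤ y e) → P y) →
  (c : Fin m → ℚ) (b : ℚ) → (∀ x → P x → b ≤ ⟨ c , x ⟩) →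
  (p : Fin m → ℚ) → P p → ⟨ c , p ⟩ ≡ b → ∀ f → 0ℚ ≤ c f
valid-tight⇒nonneg {suc m} P upward c b valid p Pp tight f =
  b≤b+x⇒0≤x (subst (b ≤_) ⟨c,raised⟩ (valid raised (upward Pp p≤raised)))
  where
  raised : Fin (suc m) → ℚ
  raised = insertAt (p ∘ punchIn f) f (p f + 1ℚ)
  p≤raised : ∀ e → p e ≤ raised e
  p≤raised = punchIn-elim (λ e → p e ≤ raised e) f
    (subst (p f ≤_) (sym (insertAt-lookup (p ∘ punchIn f) f (p f + 1ℚ)))
           (subst (_≤ p f + 1ℚ) (ℚP.+-identityʳ (p f)) (ℚP.+-monoʳ-≤ (p f) 0≤1)))
    (λ d → ℚP.≤-reflexive (sym (insertAt-punchIn (p ∘ punchIn f) f (p f + 1ℚ) d)))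
  rest : ℚ
  rest = Σℚ (λ d → c (punchIn f d) * p (punchIn f d))
  ⟨c,raised⟩ : ⟨ c , raised ⟩ ≡ b + c f
  ⟨c,raised⟩ = begin
    ⟨ c , raised ⟩                ≡⟨ Σℚ-insertAt f (p f + 1ℚ) (p ∘ punchIn f) (λ e z → c e * z) ⟩
    c f * (p f + 1ℚ) + rest       ≡⟨ solve 3 (λ cf pf r → cf :* (pf :+ con 1ℚ) :+ r := (cf :* pf :+ r) :+ cf) refl (c f) (p f) rest ⟩
    (c f * p f + rest) + c f      ≡⟨ cong (_+ c f) (Σℚ-split f (λ e → c e * p e)) ⟨
    ⟨ c , p ⟩ + c f               ≡⟨ cong (_+ c f) tight ⟩
    b + c f                       ∎

InCUT-upward : ∀ {G x y} → InCUT G x → (∀ e → x e ≤ y e) → InCUT G y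
InCUT-upward (l , ok , coeffs≡1 , combo≤x) x≤y =
  l , ok , coeffs≡1 , λ e → ℚP.≤-trans (combo≤x e) (x≤y e)

cut∈CUT : (G : Graph) (S : Subset (nodes G)) → NonTrivial S → InCUT G (χδ G S)
cut∈CUT G S nontrivial = ((1ℚ , S) ∷ []) , ((0≤1 , nontrivial) ∷ []) , ℚP.+-identityʳ 1ℚ ,
  λ e → ℚP.≤-reflexive (trans (ℚP.+-identityʳ _) (ℚP.*-identityˡ _))

combination-bound : (G : Graph) (c : Fin (edges G) → ℚ) (w : ℚ) →
  (∀ T → NonTrivial T → w ≤ cutWeight G c T) →
  ∀ l → AllOK l → w * sumCoeffs l ≤ ⟨ c , sumCombo G l ⟩
combination-bound G c w w≤cuts [] [] =
  ℚP.≤-reflexive (trans (ℚP.*-zeroʳ w) (sym (Σℚ-zero λ e → ℚP.*-zeroʳ (c e))))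
combination-bound G c w w≤cuts ((μ , S) ∷ l) ((μ≥0 , nontrivial) ∷ ok) =
  subst₂ _≤_ (sym (ℚP.*-distribˡ-+ w μ (sumCoeffs l))) (sym ⟨c,combo⟩)
    (ℚP.+-mono-≤ (subst (_≤ μ * cutWeight G c S) (ℚP.*-comm μ w)
                        (ℚP.*-monoˡ-≤-nonNeg μ {{ℚ.nonNegative μ≥0}} (w≤cuts S nontrivial)))
                 (combination-bound G c w w≤cuts l ok))
  where
  ⟨c,combo⟩ : ⟨ c , sumCombo G ((μ , S) ∷ l) ⟩ ≡ μ * cutWeight G c S + ⟨ c , sumCombo G l ⟩
  ⟨c,combo⟩ = trans (⟨⟩-+ c (λ e → μ * χδ G S e) (sumCombo G l))
                    (cong (_+ ⟨ c , sumCombo G l ⟩) (⟨⟩-* c (χδ G S) μ))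

minCut-weight : (G : Graph) (c : Fin (edges G) → ℚ) (b : ℚ) → ValidIneq G c b →
  (p : Fin (edges G) → ℚ) → InCUT G p → ⟨ c , p ⟩ ≡ b →
  ∀ S → MinCut G c S → cutWeight G c S ≡ b
minCut-weight G c b valid p p∈CUT@(l , ok , coeffs≡1 , combo≤p) tight S (nontrivial , minimal) =
  ℚP.≤-antisym weight≤b (valid (χδ G S) (cut∈CUT G S nontrivial))
  where
  c≥0 : ∀ e → 0ℚ ≤ c e
  c≥0 = valid-tight⇒nonneg (InCUT G) InCUT-upward c b valid p p∈CUT tight
  weight≤b : cutWeight G c S ≤ b
  weight≤b = ℚP.≤-trans
    (subst (_≤ ⟨ c , sumCombo G l ⟩) (trans (cong (cutWeight G c S *_) coeffs≡1) (ℚP.*-identityʳ _))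
           (combination-bound G c (cutWeight G c S) minimal l ok))
    (subst (⟨ c , sumCombo G l ⟩ ≤_) tight (⟨⟩-mono c c≥0 combo≤p))

ℤtoℚ≃ : ∀ z → ℚ.toℚᵘ (ℤtoℚ z) ≃ mkℚᵘ z 0
ℤtoℚ≃ z = ℚP.toℚᵘ-fromℚᵘ (mkℚᵘ z 0)

ℤtoℚ-injective : ∀ {x y} → ℤtoℚ x ≡ ℤtoℚ y → x ≡ y
ℤtoℚ-injective {x} {y} eq with ℚP.fromℚᵘ-injective {mkℚᵘ x 0} {mkℚᵘ y 0} eq
... | ℚᵘ.*≡* x*1≡y*1 = trans (sym (ℤP.*-identityʳ x)) (trans x*1≡y*1 (ℤP.*-identityʳ y))

ℤtoℚ-+ : ∀ x y → ℤtoℚ (x ℤ.+ y) ≡ ℤtoℚ x + ℤtoℚ y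
ℤtoℚ-+ x y = ℚP.toℚᵘ-injective (begin≃
  ℚ.toℚᵘ (ℤtoℚ (x ℤ.+ y))                  ≈⟨ ℤtoℚ≃ (x ℤ.+ y) ⟩
  mkℚᵘ (x ℤ.+ y) 0                          ≈⟨ ℚᵘ.*≡* (cong (ℤ._* ℤ.+ 1) (sym (cong₂ ℤ._+_ (ℤP.*-identityʳ x) (ℤP.*-identityʳ y)))) ⟩
  mkℚᵘ x 0 +ᵘ mkℚᵘ y 0                      ≈⟨ ℚᵘP.+-cong (ℤtoℚ≃ x) (ℤtoℚ≃ y) ⟨
  ℚ.toℚᵘ (ℤtoℚ x) +ᵘ ℚ.toℚᵘ (ℤtoℚ y)        ≈⟨ ℚP.toℚᵘ-homo-+ (ℤtoℚ x) (ℤtoℚ y) ⟨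
  ℚ.toℚᵘ (ℤtoℚ x + ℤtoℚ y)                  ∎≃)
  where open SetoidReasoning ℚᵘP.≃-setoid using (step-≈-⟩; step-≈-⟨) renaming (begin_ to begin≃_; _∎ to _∎≃)

ℤtoℚ-sum : ∀ {m} (f : Fin m → ℤ) → ℤtoℚ (ℤΣ.sum f) ≡ Σℚ (ℤtoℚ ∘ f)
ℤtoℚ-sum {zero}  f = refl
ℤtoℚ-sum {suc m} f = trans (ℤtoℚ-+ (f zero) (ℤΣ.sum (f ∘ suc))) (cong (ℤtoℚ (f zero) +_) (ℤtoℚ-sum (f ∘ suc)))

ℕtoℚ-nonzero : ∀ k → 1 ℕ.≤ k → ℕtoℚ k ≢ 0ℚ
ℕtoℚ-nonzero (suc k) _ eq with ℤtoℚ-injective {ℤ.+ suc k} {ℤ.+ 0} eq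
... | ()

∣-sum : ∀ {m} (d : ℤ) (f : Fin m → ℤ) → (∀ x → d ℤ∣.∣ f x) → d ℤ∣.∣ ℤΣ.sum f
∣-sum {zero}  d f d∣f = ℤ∣.divides (ℤ.+ 0) (sym (ℤP.*-zeroˡ d))
∣-sum {suc m} d f d∣f = ℤ∣.∣m∣n⇒∣m+n (d∣f zero) (∣-sum d (f ∘ suc) (d∣f ∘ suc))

cutTerm : (G : Graph) → (Fin (edges G) → ℤ) → Subset (nodes G) → Fin (edges G) → ℤ
cutTerm G a S x = if S (proj₁ (ends G x)) xor S (proj₂ (ends G x)) then a x else ℤ.+ 0

ℤtoℚ-cutTerm : ∀ G a S x → ℤtoℚ (cutTerm G a S x) ≡ ℤtoℚ (a x) * χδ G S x
ℤtoℚ-cutTerm G a S x with S (proj₁ (ends G x)) xor S (proj₂ (ends G x))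
... | true  = sym (ℚP.*-identityʳ (ℤtoℚ (a x)))
... | false = sym (ℚP.*-zeroʳ (ℤtoℚ (a x)))

cutTerm-∈δ : ∀ G a S x → _∈δ_ {G} x S → cutTerm G a S x ≡ a x
cutTerm-∈δ G a S x x∈δS rewrite x∈δS = refl

∣-cutTerm : ∀ G a S x {d} → d ℤ∣.∣ a x → d ℤ∣.∣ cutTerm G a S x
∣-cutTerm G a S x {d} d∣ax with S (proj₁ (ends G x)) xor S (proj₂ (ends G x))
... | true  = d∣ax
... | false = ℤ∣.divides (ℤ.+ 0) (sym (ℤP.*-zeroˡ d))

rhs≡tight-cut-weight : (G : Graph) (c : Fin (edges G) → ℚ) (b : ℚ) (a : Fin (edges G) → ℤ) (r : ℤ) → MinIntForm c b a r →
  ∀ S → cutWeight G c S ≡ b → r ≡ ℤΣ.sum (cutTerm G a S)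
rhs≡tight-cut-weight G c b a r ((t , _ , a≡tc , r≡tb) , _) S weight≡b = ℤtoℚ-injective (begin
  ℤtoℚ r                                  ≡⟨ r≡tb ⟩
  t * b                                   ≡⟨ cong (t *_) weight≡b ⟨
  t * cutWeight G c S                     ≡⟨ Σℚ-*ˡ t (λ x → c x * χδ G S x) ⟨
  Σℚ (λ x → t * (c x * χδ G S x))         ≡⟨ Σℚ-cong (λ x → trans (sym (ℚP.*-assoc t (c x) _)) (cong (_* χδ G S x) (sym (a≡tc x)))) ⟩
  Σℚ (λ x → ℤtoℚ (a x) * χδ G S x)        ≡⟨ Σℚ-cong (λ x → ℤtoℚ-cutTerm G a S x) ⟨
  Σℚ (ℤtoℚ ∘ cutTerm G a S)               ≡⟨ ℤtoℚ-sum (cutTerm G a S) ⟨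
  ℤtoℚ (ℤΣ.sum (cutTerm G a S))           ∎)

divisor-divides-coefficient : ∀ {n m} (ends : Fin (suc m) → Fin n × Fin n)
  (c : Fin (suc m) → ℚ) (b : ℚ) (a : Fin (suc m) → ℤ) (r : ℤ) → MinIntForm c b a r →
  ∀ S → cutWeight (graph n (suc m) ends) c S ≡ b → ∀ e → _∈δ_ {graph n (suc m) ends} e S →
  (d : ℕ) → (∀ x → ℤ.+ d ℤD.∣ a (punchIn e x)) → ℤ.+ d ℤD.∣ r → ℤ.+ d ℤD.∣ a e
divisor-divides-coefficient {n} ends c b a r form S weight≡b e e∈δS d d∣rest d∣r =
  ℤ∣.∣⇒∣ᵤ (subst (ℤ.+ d ℤ∣.∣_) (cutTerm-∈δ G a S e e∈δS) (ℤ∣.∣m+n∣n⇒∣m d∣split d∣others))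
  where
  G : Graph
  G = graph n _ ends
  split : r ≡ cutTerm G a S e ℤ.+ ℤΣ.sum (cutTerm G a S ∘ punchIn e)
  split = trans (rhs≡tight-cut-weight G c b a r form S weight≡b) (ℤΣ.sum-remove (cutTerm G a S))
  d∣split : ℤ.+ d ℤ∣.∣ cutTerm G a S e ℤ.+ ℤΣ.sum (cutTerm G a S ∘ punchIn e)
  d∣split = subst (ℤ.+ d ℤ∣.∣_) split (ℤ∣.∣ᵤ⇒∣ d∣r)
  d∣others : ℤ.+ d ℤ∣.∣ ℤΣ.sum (cutTerm G a S ∘ punchIn e)
  d∣others = ∣-sum (ℤ.+ d) _ λ x → ∣-cutTerm G a S (punchIn e x) (ℤ∣.∣ᵤ⇒∣ (d∣rest x))

witness⇒non-k-graph : ∀ {k G c} → Witness k G c → ¬ IsKGraph k G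
witness⇒non-k-graph {k} {G} {c} (facet , a , r , form , k<r) k-graph =
  ℤP.<⇒≱ k<r (k-graph c (ℕtoℚ k) facet a r form)

-- For a witness, every minimum cut has weight exactly k (the facet contains a
-- point of CUT(G) as soon as G has an edge).
witness-minCut-weight : ∀ {k G c} → Witness k G c → Fin (edges G) →
  ∀ S → MinCut G c S → cutWeight G c S ≡ ℕtoℚ k
witness-minCut-weight {k} {G} {c} ((valid , _ , points , tight , _) , _) e =
  minCut-weight G c (ℕtoℚ k) valid (points e) (proj₁ (tight e)) (proj₂ (tight e))

_∈δ?_ : ∀ {G} → Decidable₂ (_∈δ_ {G})
_∈δ?_ {G} x S = S (proj₁ (ends G x)) xor S (proj₂ (ends G x)) Bool.≟ true

∉δ⇒χ≡0 : ∀ {G} x S → ¬ (_∈δ_ {G} x S) → χδ G S x ≡ 0ℚ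
∉δ⇒χ≡0 {G} x S x∉δS with S (proj₁ (ends G x)) xor S (proj₂ (ends G x))
... | true  = ⊥-elim (x∉δS refl)
... | false = refl

∉δ⇒same-side : ∀ {G} x S → ¬ (_∈δ_ {G} x S) → S (proj₁ (ends G x)) ≡ S (proj₂ (ends G x))
∉δ⇒same-side {G} x S x∉δS with S (proj₁ (ends G x)) | S (proj₂ (ends G x))
... | true  | true  = refl
... | false | false = refl
... | true  | false = ⊥-elim (x∉δS refl)
... | false | true  = ⊥-elim (x∉δS refl)

∈δ⇒non-loop : ∀ {G} x S → _∈δ_ {G} x S → proj₁ (ends G x) ≢ proj₂ (ends G x)
∈δ⇒non-loop {G} x S x∈δS u≡w
  with trans (sym (xor-same (S u))) (subst (λ v → S u xor S v ≡ true) (sym u≡w) x∈δS)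
  where u = proj₁ (ends G x)
... | ()

two-nodes-separated : (S : Subset 2) → NonTrivial S → ∀ u w → u ≢ w → S u xor S w ≡ true
two-nodes-separated S ((v , Sv) , (v′ , Sv′)) = separated v v′ Sv Sv′
  where
  separated : ∀ v v′ → S v ≡ true → S v′ ≡ false → ∀ u w → u ≢ w → S u xor S w ≡ true
  separated zero       zero       Sv Sv′ with trans (sym Sv) Sv′
  ... | ()
  separated (suc zero) (suc zero) Sv Sv′ with trans (sym Sv) Sv′
  ... | ()
  separated v v′ Sv Sv′ zero zero u≢w = ⊥-elim (u≢w refl)
  separated v v′ Sv Sv′ (suc zero) (suc zero) u≢w = ⊥-elim (u≢w refl)
  separated zero (suc zero) Sv Sv′ zero (suc zero) _ rewrite Sv | Sv′ = refl
  separated zero (suc zero) Sv Sv′ (suc zero) zero _ rewrite Sv | Sv′ = refl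
  separated (suc zero) zero Sv Sv′ zero (suc zero) _ rewrite Sv | Sv′ = refl
  separated (suc zero) zero Sv Sv′ (suc zero) zero _ rewrite Sv | Sv′ = refl

data Multiplicity {m} (P : Fin m → Set) : Set where
  none       : (∀ i → ¬ P i) → Multiplicity P
  exactlyOne : ∀ i → P i → (∀ j → j ≢ i → ¬ P j) → Multiplicity P
  atLeastTwo : ∀ i j → i ≢ j → P i → P j → Multiplicity P

multiplicity : ∀ {m} {P : Fin m → Set} → Decidable P → Multiplicity P
multiplicity P? with any? P?
... | no ¬∃P = none (λ i Pi → ¬∃P (i , Pi))
... | yes (i , Pi) with any? (λ j → ¬? (j ≟ i) ×-dec P? j)
...   | yes (j , j≢i , Pj) = atLeastTwo i j (j≢i ∘ sym) Pi Pj
...   | no ¬other          = exactlyOne i Pi (λ j j≢i Pj → ¬other (j , j≢i , Pj))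

module Contraction {N M : ℕ} (ends : Fin (suc M) → Fin (suc N) × Fin (suc N)) (e : Fin (suc M))
                   (non-loop : proj₁ (ends e) ≢ proj₂ (ends e)) where

  u w : Fin (suc N)
  u = proj₁ (ends e)
  w = proj₂ (ends e)

  merge : Fin (suc N) → Fin N
  merge = mergeInto u w non-loop

  G G/e : Graph
  G   = graph (suc N) (suc M) ends
  G/e = graph N M (λ d → mapEnds merge (ends (punchIn e d)))

  G/e-minor : ProperMinor G/e G
  G/e-minor = one (contract ends e non-loop)

  merge-w : merge w ≡ punchOut (λ w≡u → non-loop (sym w≡u))
  merge-w with w ≟ w
  ... | yes _   = refl
  ... | no w≢w  = ⊥-elim (w≢w refl)

  merge-u≡merge-w : merge u ≡ merge w
  merge-u≡merge-w with u ≟ w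
  ... | yes u≡w = ⊥-elim (non-loop u≡w)
  ... | no _    = trans (punchOut-cong w refl) (sym merge-w)

  merge-punchIn : ∀ v → merge (punchIn w v) ≡ v
  merge-punchIn v with punchIn w v ≟ w
  ... | yes eq = ⊥-elim (punchInᵢ≢i w v eq)
  ... | no _   = trans (punchOut-cong w refl) (punchOut-punchIn w)

  expand : Subset N → Subset (suc N)
  expand T = T ∘ merge

  restrict : Subset (suc N) → Subset N
  restrict S = S ∘ punchIn w

  expand-restrict : ∀ S → ¬ (_∈δ_ {G} e S) → ∀ x → expand (restrict S) x ≡ S x
  expand-restrict S e∉δS x with x ≟ w
  ... | yes refl = trans (cong S (punchIn-punchOut _)) (∉δ⇒same-side {G} e S e∉δS)
  ... | no _     = cong S (punchIn-punchOut _)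

  restrict-nontrivial : ∀ S → ¬ (_∈δ_ {G} e S) → NonTrivial S → NonTrivial (restrict S)
  restrict-nontrivial S e∉δS ((v , Sv) , (v′ , Sv′)) =
    (merge v , trans (expand-restrict S e∉δS v) Sv) , (merge v′ , trans (expand-restrict S e∉δS v′) Sv′)

  expand-nontrivial : ∀ T → NonTrivial T → NonTrivial (expand T)
  expand-nontrivial T ((v , Tv) , (v′ , Tv′)) =
    (punchIn w v , trans (cong T (merge-punchIn v)) Tv) , (punchIn w v′ , trans (cong T (merge-punchIn v′)) Tv′)

  χ-expand-e : ∀ T → χδ G (expand T) e ≡ 0ℚ
  χ-expand-e T rewrite merge-u≡merge-w | xor-same (T (merge w)) = refl

  χ-restrict : ∀ S → ¬ (_∈δ_ {G} e S) → ∀ d → χδ G/e (restrict S) d ≡ χδ G S (punchIn e d)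
  χ-restrict S e∉δS d = cong₂ (λ s t → if s xor t then 1ℚ else 0ℚ)
    (expand-restrict S e∉δS (proj₁ (ends (punchIn e d)))) (expand-restrict S e∉δS (proj₂ (ends (punchIn e d))))

  expandCombination : List (ℚ × Subset N) → List (ℚ × Subset (suc N))
  expandCombination = List.map (map₂ expand)

  expand-AllOK : ∀ l → AllOK l → AllOK (expandCombination l)
  expand-AllOK []            []                        = []
  expand-AllOK ((μ , T) ∷ l) ((μ≥0 , nontrivial) ∷ ok) = (μ≥0 , expand-nontrivial T nontrivial) ∷ expand-AllOK l ok

  expand-sumCoeffs : ∀ l → sumCoeffs (expandCombination l) ≡ sumCoeffs l
  expand-sumCoeffs []            = refl
  expand-sumCoeffs ((μ , T) ∷ l) = cong (μ +_) (expand-sumCoeffs l)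

  expand-sumCombo-e : ∀ l → sumCombo G (expandCombination l) e ≡ 0ℚ
  expand-sumCombo-e []            = refl
  expand-sumCombo-e ((μ , T) ∷ l) =
    trans (cong₂ _+_ (trans (cong (μ *_) (χ-expand-e T)) (ℚP.*-zeroʳ μ)) (expand-sumCombo-e l)) (ℚP.+-identityʳ 0ℚ)

  expand-sumCombo-punchIn : ∀ l d → sumCombo G (expandCombination l) (punchIn e d) ≡ sumCombo G/e l d
  expand-sumCombo-punchIn []            d = refl
  expand-sumCombo-punchIn ((μ , T) ∷ l) d = cong (μ * χδ G/e T d +_) (expand-sumCombo-punchIn l d)

  expand-InCUT : ∀ x → InCUT G/e x → InCUT G (insertAt x e 0ℚ)
  expand-InCUT x (l , ok , coeffs≡1 , combo≤x) =
    expandCombination l , expand-AllOK l ok , trans (expand-sumCoeffs l) coeffs≡1 ,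
    punchIn-elim (λ y → sumCombo G (expandCombination l) y ≤ insertAt x e 0ℚ y) e
      (subst₂ _≤_ (sym (expand-sumCombo-e l)) (sym (insertAt-lookup x e 0ℚ)) ℚP.≤-refl)
      (λ d → subst₂ _≤_ (sym (expand-sumCombo-punchIn l d)) (sym (insertAt-punchIn x e 0ℚ d)) (combo≤x d))

  module _ (c : Fin (suc M) → ℚ) where
    c/e : Fin M → ℚ
    c/e = c ∘ punchIn e

    valid-contract : ∀ b → ValidIneq G c b → ValidIneq G/e c/e b
    valid-contract b valid x x∈CUT = subst (b ≤_) ⟨c,x₀⟩ (valid (insertAt x e 0ℚ) (expand-InCUT x x∈CUT))
      where
      ⟨c,x₀⟩ : ⟨ c , insertAt x e 0ℚ ⟩ ≡ ⟨ c/e , x ⟩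
      ⟨c,x₀⟩ = trans (Σℚ-insertAt e 0ℚ x (λ y z → c y * z)) (trans (cong (_+ ⟨ c/e , x ⟩) (ℚP.*-zeroʳ (c e))) (ℚP.+-identityˡ _))

    cutWeight-restrict : ∀ S → ¬ (_∈δ_ {G} e S) → cutWeight G/e c/e (restrict S) ≡ cutWeight G c S
    cutWeight-restrict S e∉δS = sym (begin
      cutWeight G c S          ≡⟨ Σℚ-split e (λ x → c x * χδ G S x) ⟩
      c e * χδ G S e + rest    ≡⟨ cong (λ z → c e * z + rest) (∉δ⇒χ≡0 {G} e S e∉δS) ⟩
      c e * 0ℚ + rest          ≡⟨ cong (_+ rest) (ℚP.*-zeroʳ (c e)) ⟩
      0ℚ + rest                ≡⟨ ℚP.+-identityˡ rest ⟩
      rest                     ≡⟨ Σℚ-cong (λ d → cong (c/e d *_) (χ-restrict S e∉δS d)) ⟨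
      cutWeight G/e c/e (restrict S) ∎)
      where
      rest : ℚ
      rest = Σℚ (λ d → c/e d * χδ G S (punchIn e d))

    -- Main step: if e lies in exactly one cut δ(F i₀) of a basis of minimum
    -- cuts for a witness ⟨c,x⟩ ≥ k of G, then ⟨c/e,x⟩ ≥ k is a witness for G/e
    -- (provided G/e still has an edge j₀): the other |E|-1 basis cuts avoid e and
    -- give |E|-1 independent points of the facet of CUT(G/e), and the minimum
    -- integer form keeps its right-hand side since a(e) is determined by the others.
    contraction-witness : ∀ {k} → 1 ℕ.≤ k → Witness k G c →
      (F : Fin (suc M) → Subset (suc N)) → BasisOfMinCuts G c F →
      ∀ i₀ → _∈δ_ {G} e (F i₀) → (∀ j → j ≢ i₀ → ¬ (_∈δ_ {G} e (F j))) →
      Fin M → Witness k G/e c/e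
    contraction-witness {k} k≥1 witness@((valid , _) , a , r , form@((t , t>0 , a≡tc , r≡tk) , coprime) , k<r)
                        F (minimal , independent)
                        i₀ e∈δF₀ unique j₀ =
      (valid-contract (ℕtoℚ k) valid , nonzero , points , on-facet , affinely-independent) ,
      a ∘ punchIn e , r , form′ , k<r
      where
      weight : ∀ i → cutWeight G c (F i) ≡ ℕtoℚ k
      weight i = witness-minCut-weight witness e (F i) (minimal i)

      others : Fin M → Subset (suc N)
      others = F ∘ punchIn i₀

      avoid : ∀ j → ¬ (_∈δ_ {G} e (others j))
      avoid j = unique (punchIn i₀ j) (punchInᵢ≢i i₀ j)

      points : Fin M → Fin M → ℚ
      points j = χδ G/e (restrict (others j))

      on-facet : ∀ j → InCUT G/e (points j) × (⟨ c/e , points j ⟩ ≡ ℕtoℚ k)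
      on-facet j = cut∈CUT G/e _ (restrict-nontrivial (others j) (avoid j) (proj₁ (minimal (punchIn i₀ j)))) ,
                   trans (cutWeight-restrict (others j) (avoid j)) (weight (punchIn i₀ j))

      nonzero : ∃ λ d → c/e d ≢ 0ℚ
      nonzero = ¬∀⟶∃¬ M (λ d → c/e d ≡ 0ℚ) (λ d → c/e d ℚP.≟ 0ℚ) λ c/e≡0 →
        ℕtoℚ-nonzero k k≥1 (trans (sym (proj₂ (on-facet j₀)))
          (Σℚ-zero λ d → trans (cong (_* points j₀ d) (c/e≡0 d)) (ℚP.*-zeroˡ (points j₀ d))))

      affinely-independent : AffinelyIndependent points
      affinely-independent μ _ = independent-cong (λ j d → sym (χ-restrict (others j) (avoid j) d))
        (independent-drop-coordinate (λ j → χδ G (others j)) e (λ j → ∉δ⇒χ≡0 {G} e (others j) (avoid j))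
          (independent-subfamily (λ i → χδ G (F i)) i₀ independent)) μ

      form′ : MinIntForm c/e (ℕtoℚ k) (a ∘ punchIn e) r
      form′ = (t , t>0 , a≡tc ∘ punchIn e , r≡tk) , coprime′
        where
        coprime′ : ∀ d → (∀ x → ℤ.+ d ℤD.∣ a (punchIn e x)) → ℤ.+ d ℤD.∣ r → d ≡ 1
        coprime′ d d∣a′ d∣r = coprime d
          (punchIn-elim (λ x → ℤ.+ d ℤD.∣ a x) e
            (divisor-divides-coefficient ends c (ℕtoℚ k) a r form (F i₀) (weight i₀) e e∈δF₀ d d∣a′ d∣r) d∣a′)
          d∣r

-- If e is the only edge, the minimum
-- integer form would have right-hand side ±1; on two nodes every basis cut
-- contains e; otherwise contracting e yields a witness for the proper minor G/e.
unique-cut-impossible : ∀ k → 1 ℕ.≤ k → (G : Graph) → IsGraph G → MinorMinimalNonK k G →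
  (c : Fin (edges G) → ℚ) → Witness k G c →
  (F : Fin (edges G) → Subset (nodes G)) → BasisOfMinCuts G c F →
  ∀ e i₀ → _∈δ_ {G} e (F i₀) → (∀ j → j ≢ i₀ → ¬ (_∈δ_ {G} e (F j))) → ⊥
unique-cut-impossible k k≥1 (graph n 1 ends) _ _ c witness@(_ , a , r , form , k<r) F (minimal , _)
                      zero zero e∈δF₀ _ = ∣r∣≢1 k<r (proj₂ form ℤ.∣ r ∣ ∣r∣∣a ℕD.∣-refl)
  where
  ∣r∣∣a : ∀ x → ℤ.+ ℤ.∣ r ∣ ℤD.∣ a x
  ∣r∣∣a zero = divisor-divides-coefficient ends c (ℕtoℚ k) a r form (F zero)
    (witness-minCut-weight witness zero (F zero) (minimal zero)) zero e∈δF₀ ℤ.∣ r ∣ (λ ()) ℕD.∣-refl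
  ∣r∣≢1 : ∀ {r} → ℤ.+ k ℤ.< r → ℤ.∣ r ∣ ≢ 1
  ∣r∣≢1 (ℤ.+<+ k<1) refl = ℕP.<⇒≱ k<1 k≥1
unique-cut-impossible k k≥1 (graph 0 (suc (suc m)) ends) () _ c _ F _ e i₀ _ _
unique-cut-impossible k k≥1 (graph 1 (suc (suc m)) ends) (ℕ.s≤s ()) _ c _ F _ e i₀ _ _
unique-cut-impossible k k≥1 (graph 2 (suc (suc m)) ends) _ _ c _ F (minimal , _) e i₀ e∈δF₀ unique =
  unique j (punchInᵢ≢i i₀ zero)
    (two-nodes-separated (F j) (proj₁ (minimal j)) _ _ (∈δ⇒non-loop {graph 2 _ ends} e (F i₀) e∈δF₀))
  where
  j : Fin (suc (suc m))
  j = punchIn i₀ zero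
unique-cut-impossible k k≥1 (graph (suc (suc (suc n))) (suc (suc m)) ends) _ (_ , minors-are-k-graphs)
                      c witness F basis e i₀ e∈δF₀ unique =
  witness⇒non-k-graph (contraction-witness c k≥1 witness F basis i₀ e∈δF₀ unique zero)
    (minors-are-k-graphs G/e G/e-minor (ℕ.s≤s (ℕ.s≤s ℕ.z≤n)))
  where open Contraction ends e (∈δ⇒non-loop {graph _ _ ends} e (F i₀) e∈δF₀)

lemma2p6 : (k : ℕ) → 1 ℕ.≤ k → (G : Graph) → IsGraph G → MinorMinimalNonK k G →
    (c : Fin (edges G) → ℚ) → Witness k G c →
    (F : Fin (edges G) → Subset (nodes G)) → BasisOfMinCuts G c F →
    ∀ (e : Fin (edges G)) → ∃[ i ] ∃[ j ] (i ≢ j) × (_∈δ_ {G} e (F i)) × (_∈δ_ {G} e (F j))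
lemma2p6 k k≥1 G isGraph minimal c witness F basis e with multiplicity (λ i → _∈δ?_ {G} e (F i))
... | none e∉δF =
  ⊥-elim (independent-uses-coordinate (λ i → χδ G (F i)) (proj₂ basis) e (λ i → ∉δ⇒χ≡0 {G} e (F i) (e∉δF i)))
... | exactlyOne i₀ e∈δF₀ unique =
  ⊥-elim (unique-cut-impossible k k≥1 G isGraph minimal c witness F basis e i₀ e∈δF₀ unique)
... | atLeastTwo i j i≢j e∈δFᵢ e∈δFⱼ = i , j , i≢j , e∈δFᵢ , e∈δFⱼ
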